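{- Let $G$ be a finite simple graph, let $T$ be a clique in $G$, and let $z$ be a vertex of $T$ with $\deg(z)=|T|-1$. Then $z$ is either a critical vertex or an uncritical vertex, and $Z(G\setminus z)\in\{Z(G),Z(G)-1\}$.
   Context: Zero forcing rule: a filled vertex $v$ forces an unfilled vertex $u$ if $u$ is the only unfilled neighbor of $v$; each vertex forces at most once. A zero forcing set is an initially filled set from which repeated forcing fills all vertices; $Z(G)$ is the minimum size of a zero forcing set, and such a set of minimum size is optimal. An optimal forcing sequence is a sequence of valid forces from an optimal zero forcing set after which no further forces are possible. A forcing sequence yields forcing chains: maximal sequences $(v_0,\dots,v_\ell)$ with each $v_{i-1}\to v_i$ a force of the sequence; for $\ell\ge1$, $v_0$ is the source and $v_\ell$ the terminal vertex (chains of length $0$ have neither). A vertex is critical if there is some optimal forcing sequence in which it neither forces nor gets forced; it is uncritical if for every optimal forcing sequence it is the source or the terminal vertex of its chain. $G\setminus z$ is $G$ with $z$ deleted. -}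

module Defs where

open import Data.Nat using (ℕ; zero; suc; _≤_; _+_)
open import Data.Fin using (Fin; punchIn; _≟_)
open import Data.Fin.Subset using (Subset; ∣_∣; _∈_)
open import Data.Bool using (Bool; true; false; if_then_else_)
open import Data.Vec using (Vec; lookup; tabulate)
open import Data.List using (List; []; _∷_; map)
open import Data.Product using (Σ; _×_; _,_; proj₁; proj₂)
open import Data.Unit using (⊤)
open import Data.Empty using (⊥)
open import Data.Sum using (_⊎_)
import Data.List.Membership.Propositional as LM
open import Relation.Nullary using (¬_; yes; no)
open import Relation.Binary.PropositionalEquality using (_≡_; _≢_)

record Graph (n : ℕ) : Set where
  field
    adj   : Fin n → Fin n → Bool
    sym   : ∀ u v → adj u v ≡ adj v u
    irrefl : ∀ v → adj v v ≡ false
open Graph public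

deg : ∀ {n} → Graph n → Fin n → ℕ
deg G v = ∣ tabulate (adj G v) ∣

IsClique : ∀ {n} → Graph n → Subset n → Set
IsClique G T = ∀ u v → u ∈ T → v ∈ T → u ≢ v → adj G u v ≡ true

deleteVertex : ∀ {m} → Graph (suc m) → Fin (suc m) → Graph m
deleteVertex G z = record
  { adj = λ i j → adj G (punchIn z i) (punchIn z j)
  ; sym = λ i j → sym G (punchIn z i) (punchIn z j)
  ; irrefl = λ i → irrefl G (punchIn z i) }

Filling : ℕ → Set
Filling n = Fin n → Bool

fill : ∀ {n} → Filling n → Fin n → Filling n
fill F u w with w ≟ u
... | yes _ = true
... | no  _ = F w

CanForce : ∀ {n} → Graph n → Filling n → Fin n → Fin n → Set
CanForce G F v u =
  (F v ≡ true) × (F u ≡ false) × (adj G v u ≡ true) ×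
  (∀ w → adj G v w ≡ true → F w ≡ false → w ≡ u)

-- A force is a pair (v , u) meaning v → u.
Force : ℕ → Set
Force n = Fin n × Fin n

-- Validity of a sequence of forces from filling F, given the list `used`
-- of vertices that have already forced (each vertex forces at most once).
ValidFrom : ∀ {n} → Graph n → Filling n → List (Fin n) → List (Force n) → Set
ValidFrom G F used [] = ⊤
ValidFrom G F used ((v , u) ∷ rest) =
  CanForce G F v u × ¬ (v LM.∈ used) × ValidFrom G (fill F u) (v ∷ used) rest

after : ∀ {n} → Filling n → List (Force n) → Filling n
after F [] = F
after F ((v , u) ∷ rest) = after (fill F u) rest

usedAfter : ∀ {n} → List (Fin n) → List (Force n) → List (Fin n)
usedAfter used [] = used
usedAfter used ((v , u) ∷ rest) = usedAfter (v ∷ used) rest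

initial : ∀ {n} → Subset n → Filling n
initial S = lookup S

ValidSeq : ∀ {n} → Graph n → Subset n → List (Force n) → Set
ValidSeq G S seq = ValidFrom G (initial S) [] seq

Maximal : ∀ {n} → Graph n → Subset n → List (Force n) → Set
Maximal G S seq =
  ¬ (Σ _ λ v → Σ _ λ u →
       CanForce G (after (initial S) seq) v u × ¬ (v LM.∈ usedAfter [] seq))

IsZeroForcingSet : ∀ {n} → Graph n → Subset n → Set
IsZeroForcingSet G S =
  Σ _ λ seq → ValidSeq G S seq × (∀ w → after (initial S) seq w ≡ true)

IsZ : ∀ {n} → Graph n → ℕ → Set
IsZ G k =
  (Σ _ λ S → IsZeroForcingSet G S × ∣ S ∣ ≡ k) ×
  (∀ S → IsZeroForcingSet G S → k ≤ ∣ S ∣)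

IsOptimal : ∀ {n} → Graph n → Subset n → Set
IsOptimal G S =
  IsZeroForcingSet G S × (∀ S′ → IsZeroForcingSet G S′ → ∣ S ∣ ≤ ∣ S′ ∣)

IsOptimalForcingSeq : ∀ {n} → Graph n → Subset n → List (Force n) → Set
IsOptimalForcingSeq G S seq = IsOptimal G S × ValidSeq G S seq × Maximal G S seq

Forces : ∀ {n} → Fin n → List (Force n) → Set
Forces v seq = v LM.∈ map proj₁ seq

Forced : ∀ {n} → Fin n → List (Force n) → Set
Forced v seq = v LM.∈ map proj₂ seq

-- v is the source of its chain (chain of length ≥ 1): it forces but is not forced
IsSource : ∀ {n} → Fin n → List (Force n) → Set
IsSource v seq = Forces v seq × ¬ Forced v seq

-- v is the terminal vertex of its chain (length ≥ 1): forced but does not force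
IsTerminal : ∀ {n} → Fin n → List (Force n) → Set
IsTerminal v seq = Forced v seq × ¬ Forces v seq

Critical : ∀ {n} → Graph n → Fin n → Set
Critical G v =
  Σ _ λ S → Σ _ λ seq →
    IsOptimalForcingSeq G S seq × ¬ Forces v seq × ¬ Forced v seq

Uncritical : ∀ {n} → Graph n → Fin n → Set
Uncritical G v =
  ∀ S seq → IsOptimalForcingSeq G S seq → (IsSource v seq ⊎ IsTerminal v seq)

{-# OPTIONS --safe #-}
-- The neighbourhood of z is T ∖ z, a clique; so once some w forces z, every other neighbour
-- of z is already filled and z cannot force as well. Given a zero forcing set S of G, deleting z
-- (and adding the vertex z forces, if any; then z ∈ S) gives a zero forcing set of G ∖ z, so
-- Z(G ∖ z) ≤ Z(G). Adding z to a zero forcing set of G ∖ z gives one of G in which z stays idle,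
-- so Z(G) ≤ Z(G ∖ z) + 1, and when equality holds this set is optimal and z is critical. When
-- Z(G ∖ z) = Z(G), an optimal sequence leaving z idle would yield a zero forcing set of G ∖ z of
-- size Z(G) − 1, so z is uncritical. Transport of zero forcing sets between G and G ∖ z uses that
-- S is zero forcing iff every stable filling (one admitting no force) containing S is full.
module Submission where

open import Defs hiding (sym)
open import Data.Bool using (Bool; true; false)
import Data.Bool.Properties as Bool
open import Data.Empty using (⊥; ⊥-elim)
open import Data.Fin using (Fin; zero; suc; punchIn; punchOut; _≟_)
open import Data.Fin.Properties using (any?; all?; punchIn-injective; punchInᵢ≢i; punchIn-punchOut)
open import Data.Fin.Subset using (Subset; inside; outside; ∣_∣; _∈_; _∉_; _⊆_; _∪_; ⁅_⁆; ⊤)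
open import Data.Fin.Subset.Properties
  using (_∈?_; p⊂q⇒∣p∣<∣q∣; ∣p∣≤∣x∷p∣; ∣⊤∣≡n; ∈⊤; ⊆⊤; ∣⁅x⁆∣≡1; x∈⁅x⁆; p⊆p∪q; q⊆p∪q;
         anySubset?)
open import Data.List using (List; []; _∷_; map)
open import Data.List.Relation.Unary.Any using (here; there)
open import Data.List.Membership.Propositional using () renaming (_∈_ to _∈ₗ_)
open import Data.List.Membership.Propositional.Properties using (∈-map⁺; ∈-map⁻)
import Data.List.Membership.DecPropositional as DecMembership
open import Data.Nat using (ℕ; zero; suc; _+_; _≤_; _<_; z≤n; s≤s)
import Data.Nat as ℕ
open import Data.Nat.Properties
  using (≤-trans; ≤-reflexive; ≤-antisym; ≤-pred; <⇒≱; ≤∧≢⇒<; m≤m+n; m≤n⇒m<n∨m≡n;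
         +-comm; +-suc; +-identityʳ; 1+n≰n; +-monoʳ-≤; +-monoʳ-<; suc-injective; module ≤-Reasoning)
open import Data.Product using (Σ; ∃; _×_; _,_; proj₁; proj₂)
open import Data.Sum using (_⊎_; inj₁; inj₂)
open import Data.Unit using (tt)
open import Data.Vec using (Vec; []; _∷_; lookup; tabulate; insertAt; removeAt)
open import Data.Vec.Properties
  using ([]=⇒lookup; lookup⇒[]=; lookup∘tabulate; insertAt-lookup; insertAt-punchIn; insertAt-removeAt)
open import Function using (_∘_; id)
open import Relation.Nullary using (¬_; Dec; yes; no)
open import Relation.Nullary.Decidable using (_×-dec_; _→-dec_; ¬?)
open import Relation.Nullary.Negation using (contradiction)
open import Relation.Unary using (Decidable)
open import Relation.Binary.PropositionalEquality
  using (_≡_; _≢_; refl; sym; trans; cong; subst; module ≡-Reasoning)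

true≢false : true ≢ false
true≢false ()

least : ∀ {p} {P : ℕ → Set p} → Decidable P → ∀ {n} → P n →
        Σ ℕ λ k → P k × (∀ j → P j → k ≤ j)
least {P = P} P? {n} Pn = search 0 n (λ _ _ → z≤n) (subst P (sym (+-identityʳ n)) Pn)
  where
  search : ∀ j d → (∀ i → P i → j ≤ i) → P (d + j) → Σ ℕ λ k → P k × (∀ i → P i → k ≤ i)
  search j d below P[d+j] with P? j
  ... | yes Pj = j , Pj , below
  search j zero    below Pj     | no ¬Pj = contradiction Pj ¬Pj
  search j (suc d) below P[d+j] | no ¬Pj =
    search (suc j) d (λ i Pi → ≤∧≢⇒< (below i Pi) (λ j≡i → ¬Pj (subst P (sym j≡i) Pi)))
      (subst P (sym (+-suc d j)) P[d+j])

≡-or-punchIn : ∀ {n} (i j : Fin (suc n)) → j ≡ i ⊎ ∃ λ k → j ≡ punchIn i k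
≡-or-punchIn i j with j ≟ i
... | yes j≡i = inj₁ j≡i
... | no  j≢i = inj₂ (punchOut (j≢i ∘ sym) , sym (punchIn-punchOut (j≢i ∘ sym)))

_∈ₗ?_ : ∀ {n} (x : Fin n) (xs : List (Fin n)) → Dec (x ∈ₗ xs)
_∈ₗ?_ = DecMembership._∈?_ _≟_

removeAt-punchIn : ∀ {a} {A : Set a} {n} (xs : Vec A (suc n)) i j →
                   lookup (removeAt xs i) j ≡ lookup xs (punchIn i j)
removeAt-punchIn (x ∷ xs)     zero    j       = refl
removeAt-punchIn (x ∷ y ∷ xs) (suc i) zero    = refl
removeAt-punchIn (x ∷ y ∷ xs) (suc i) (suc j) = removeAt-punchIn (y ∷ xs) i j

∈-removeAt⁺ : ∀ {n} (p : Subset (suc n)) i {j} → punchIn i j ∈ p → j ∈ removeAt p i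
∈-removeAt⁺ p i {j} x∈p = lookup⇒[]= j (removeAt p i) (trans (removeAt-punchIn p i j) ([]=⇒lookup x∈p))

∈-removeAt⁻ : ∀ {n} (p : Subset (suc n)) i {j} → j ∈ removeAt p i → punchIn i j ∈ p
∈-removeAt⁻ p i {j} j∈p = lookup⇒[]= (punchIn i j) p (trans (sym (removeAt-punchIn p i j)) ([]=⇒lookup j∈p))

∈-tabulate⁺ : ∀ {n} (f : Fin n → Bool) {x} → f x ≡ true → x ∈ tabulate f
∈-tabulate⁺ f {x} fx = lookup⇒[]= x (tabulate f) (trans (lookup∘tabulate f x) fx)

∈-tabulate⁻ : ∀ {n} (f : Fin n → Bool) {x} → x ∈ tabulate f → f x ≡ true
∈-tabulate⁻ f {x} x∈f = trans (sym (lookup∘tabulate f x)) ([]=⇒lookup x∈f)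

∉-tabulate : ∀ {n} (f : Fin n → Bool) {x} → f x ≡ false → x ∉ tabulate f
∉-tabulate f fx x∈f = true≢false (trans (sym (∈-tabulate⁻ f x∈f)) fx)

∣insertAt∣ : ∀ {n} (p : Subset n) i x → ∣ insertAt p i x ∣ ≡ ∣ x ∷ p ∣
∣insertAt∣ p             zero    x       = refl
∣insertAt∣ (inside ∷ p)  (suc i) inside  = cong suc (∣insertAt∣ p i inside)
∣insertAt∣ (inside ∷ p)  (suc i) outside = cong suc (∣insertAt∣ p i outside)
∣insertAt∣ (outside ∷ p) (suc i) inside  = ∣insertAt∣ p i inside
∣insertAt∣ (outside ∷ p) (suc i) outside = ∣insertAt∣ p i outside

∣p∣≡∣lookup∷removeAt∣ : ∀ {n} (p : Subset (suc n)) i → ∣ p ∣ ≡ ∣ lookup p i ∷ removeAt p i ∣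
∣p∣≡∣lookup∷removeAt∣ p i =
  trans (cong ∣_∣ (sym (insertAt-removeAt p i))) (∣insertAt∣ (removeAt p i) i (lookup p i))

x∈p⇒∣p∣≡suc∣removeAt∣ : ∀ {n} {p : Subset (suc n)} {x} → x ∈ p → ∣ p ∣ ≡ suc ∣ removeAt p x ∣
x∈p⇒∣p∣≡suc∣removeAt∣ {p = p} {x} x∈p =
  trans (∣p∣≡∣lookup∷removeAt∣ p x) (cong (λ b → ∣ b ∷ removeAt p x ∣) ([]=⇒lookup x∈p))

x∉p⇒∣p∣≡∣removeAt∣ : ∀ {n} {p : Subset (suc n)} {x} → x ∉ p → ∣ p ∣ ≡ ∣ removeAt p x ∣
x∉p⇒∣p∣≡∣removeAt∣ {p = p} {x} x∉p =
  trans (∣p∣≡∣lookup∷removeAt∣ p x)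
        (cong (λ b → ∣ b ∷ removeAt p x ∣) (Bool.¬-not (x∉p ∘ lookup⇒[]= x p)))

∣removeAt∣≤∣p∣ : ∀ {n} (p : Subset (suc n)) i → ∣ removeAt p i ∣ ≤ ∣ p ∣
∣removeAt∣≤∣p∣ p i =
  subst (∣ removeAt p i ∣ ≤_) (sym (∣p∣≡∣lookup∷removeAt∣ p i))
        (∣p∣≤∣x∷p∣ (lookup p i) (removeAt p i))

∣p∪q∣≤∣p∣+∣q∣ : ∀ {n} (p q : Subset n) → ∣ p ∪ q ∣ ≤ ∣ p ∣ + ∣ q ∣
∣p∪q∣≤∣p∣+∣q∣ []            []            = z≤n
∣p∪q∣≤∣p∣+∣q∣ (inside ∷ p)  (y ∷ q)       =
  s≤s (≤-trans (∣p∪q∣≤∣p∣+∣q∣ p q) (+-monoʳ-≤ ∣ p ∣ (∣p∣≤∣x∷p∣ y q)))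
∣p∪q∣≤∣p∣+∣q∣ (outside ∷ p) (inside ∷ q)  =
  ≤-trans (s≤s (∣p∪q∣≤∣p∣+∣q∣ p q)) (≤-reflexive (sym (+-suc ∣ p ∣ ∣ q ∣)))
∣p∪q∣≤∣p∣+∣q∣ (outside ∷ p) (outside ∷ q) = ∣p∪q∣≤∣p∣+∣q∣ p q

p⊆q∧∣q∣≤∣p∣⇒q⊆p : ∀ {n} {p q : Subset n} → p ⊆ q → ∣ q ∣ ≤ ∣ p ∣ → q ⊆ p
p⊆q∧∣q∣≤∣p∣⇒q⊆p {p = p} p⊆q ∣q∣≤∣p∣ {x} x∈q with x ∈? p
... | yes x∈p = x∈p
... | no  x∉p = contradiction ∣q∣≤∣p∣ (<⇒≱ (p⊂q⇒∣p∣<∣q∣ (p⊆q , x , x∈q , x∉p)))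

infix 4 _⊆ᶠ_

_⊆ᶠ_ : ∀ {n} → Filling n → Filling n → Set
F ⊆ᶠ C = ∀ w → F w ≡ true → C w ≡ true

Full : ∀ {n} → Filling n → Set
Full F = ∀ w → F w ≡ true

⊆ᶠ-unfilled : ∀ {n} {F C : Filling n} → F ⊆ᶠ C → ∀ {w} → C w ≡ false → F w ≡ false
⊆ᶠ-unfilled F⊆C {w} Cw = Bool.¬-not (λ Fw → true≢false (trans (sym (F⊆C w Fw)) Cw))

⊆ᶠ⇒∣∣< : ∀ {n} {F C : Filling n} {u} → F ⊆ᶠ C → F u ≡ false → C u ≡ true →
          ∣ tabulate F ∣ < ∣ tabulate C ∣
⊆ᶠ⇒∣∣< {F = F} {C} {u} F⊆C Fu Cu =
  p⊂q⇒∣p∣<∣q∣ ((λ {x} x∈F → ∈-tabulate⁺ C (F⊆C x (∈-tabulate⁻ F x∈F))) ,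
               u , ∈-tabulate⁺ C Cu , ∉-tabulate F Fu)

fill-self : ∀ {n} (F : Filling n) u → fill F u u ≡ true
fill-self F u with u ≟ u
... | yes _   = refl
... | no  u≢u = contradiction refl u≢u

fill-other : ∀ {n} (F : Filling n) {u w} → w ≢ u → fill F u w ≡ F w
fill-other F {u} {w} w≢u with w ≟ u
... | yes w≡u = contradiction w≡u w≢u
... | no  _   = refl

fill-⊇ : ∀ {n} (F : Filling n) u → F ⊆ᶠ fill F u
fill-⊇ F u w Fw with w ≟ u
... | yes _ = refl
... | no  _ = Fw

fill-⊆ : ∀ {n} {F C : Filling n} {u} → F ⊆ᶠ C → C u ≡ true → fill F u ⊆ᶠ C
fill-⊆ {F = F} {u = u} F⊆C Cu w h with w ≟ u
... | yes refl = Cu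
... | no  _    = F⊆C w h

fill-unfilled : ∀ {n} (F : Filling n) {u w} → fill F u w ≡ false → w ≢ u × F w ≡ false
fill-unfilled F {u} h =
  (λ { refl → true≢false (trans (sym (fill-self F u)) h) }) , ⊆ᶠ-unfilled (fill-⊇ F u) h

after-⊇ : ∀ {n} s (F : Filling n) → F ⊆ᶠ after F s
after-⊇ []            F w Fw = Fw
after-⊇ ((v , u) ∷ s) F w Fw = after-⊇ s (fill F u) w (fill-⊇ F u w Fw)

unforced-after : ∀ {n} s (F : Filling n) {w} → ¬ Forced w s → after F s w ≡ F w
unforced-after []            F unforced = refl
unforced-after ((v , u) ∷ s) F unforced =
  trans (unforced-after s (fill F u) (unforced ∘ there)) (fill-other F (unforced ∘ here))

unforced⇒initial : ∀ {n} {S : Subset n} {s w} → Full (after (initial S) s) → ¬ Forced w s → w ∈ S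
unforced⇒initial {S = S} {s} {w} full unforced =
  lookup⇒[]= w S (trans (sym (unforced-after s (initial S) unforced)) (full w))

module ZeroForcing {n : ℕ} (H : Graph n) where

  Stable : Filling n → Set
  Stable C = ∀ v u → ¬ CanForce H C v u

  Exhausted : Filling n → List (Fin n) → Set
  Exhausted F used = ¬ (Σ _ λ v → Σ _ λ u → CanForce H F v u × ¬ (v ∈ₗ used))

  Saturated : Filling n → List (Fin n) → Set
  Saturated F used = ∀ v → v ∈ₗ used → ∀ w → adj H v w ≡ true → F w ≡ true

  Absorbs : Filling n → Force n → Set
  Absorbs C (v , u) = ∀ F → F ⊆ᶠ C → CanForce H F v u → C u ≡ true

  canForce-mono : ∀ {F C v u} → F ⊆ᶠ C → C u ≡ false → CanForce H F v u → CanForce H C v u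
  canForce-mono F⊆C Cu (Fv , _ , vu , only) =
    F⊆C _ Fv , Cu , vu , λ w vw Cw → only w vw (⊆ᶠ-unfilled F⊆C Cw)

  stable⇒absorbs : ∀ {C} → Stable C → ∀ f → Absorbs C f
  stable⇒absorbs stable (v , u) F F⊆C canF =
    Bool.¬-not λ Cu → stable v u (canForce-mono F⊆C Cu canF)

  after-⊆ : ∀ {C} s F used → ValidFrom H F used s → (∀ {f} → f ∈ₗ s → Absorbs C f) →
            F ⊆ᶠ C → after F s ⊆ᶠ C
  after-⊆ []            F used _                  absorbs F⊆C = F⊆C
  after-⊆ ((v , u) ∷ s) F used (canF , _ , valid) absorbs F⊆C =
    after-⊆ s (fill F u) (v ∷ used) valid (absorbs ∘ there)
      (fill-⊆ F⊆C (absorbs (here refl) F F⊆C canF))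

  saturated-after : ∀ s F used → ValidFrom H F used s → Saturated F used →
                    Saturated (after F s) (usedAfter used s)
  saturated-after []            F used _                              sat = sat
  saturated-after ((v , u) ∷ s) F used ((_ , _ , _ , only) , _ , valid) sat =
    saturated-after s (fill F u) (v ∷ used) valid sat′
    where
    sat′ : Saturated (fill F u) (v ∷ used)
    sat′ _ (here refl) w vw with F w in Fw
    ... | true  = fill-⊇ F u w Fw
    ... | false = subst (λ x → fill F u x ≡ true) (sym (only w vw Fw)) (fill-self F u)
    sat′ x (there x∈used) w xw = fill-⊇ F u w (sat x x∈used w xw)

  exhausted⇒stable : ∀ s F → ValidFrom H F [] s → Exhausted (after F s) (usedAfter [] s) →
                     Stable (after F s)
  exhausted⇒stable s F valid exhausted v u canF@(_ , Fu , vu , _)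
    with v ∈ₗ? usedAfter [] s
  ... | yes v∈used = true≢false (trans (sym (saturated-after s F [] valid (λ _ ()) v v∈used u vu)) Fu)
  ... | no  v∉used = exhausted (v , u , canF , v∉used)

  full⇒exhausted : ∀ {F used} → Full F → Exhausted F used
  full⇒exhausted full (_ , u , (_ , Fu , _) , _) = true≢false (trans (sym (full u)) Fu)

  zfs⇒stable-full : ∀ {S C} → IsZeroForcingSet H S → Stable C → initial S ⊆ᶠ C → Full C
  zfs⇒stable-full (s , valid , full) stable S⊆C w =
    after-⊆ s _ [] valid (λ {f} _ → stable⇒absorbs stable f) S⊆C w (full w)

  maximal⇒full : ∀ {S s} → IsZeroForcingSet H S → ValidSeq H S s → Maximal H S s →
                 Full (after (initial S) s)
  maximal⇒full {S} {s} zfs valid maximal =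
    zfs⇒stable-full {S} zfs (exhausted⇒stable s (initial S) valid maximal) (after-⊇ s (initial S))

  canForce? : ∀ F v u → Dec (CanForce H F v u)
  canForce? F v u =
    F v Bool.≟ true ×-dec F u Bool.≟ false ×-dec adj H v u Bool.≟ true ×-dec
    all? (λ w → adj H v w Bool.≟ true →-dec F w Bool.≟ false →-dec w ≟ u)

  -- Every force fills a new vertex, so n units of fuel suffice.
  exhaust : ∀ fuel F used → n ≤ fuel + ∣ tabulate F ∣ →
            Σ _ λ s → ValidFrom H F used s × Exhausted (after F s) (usedAfter used s)
  exhaust fuel F used bound with any? (λ v → any? (λ u → canForce? F v u ×-dec ¬? (v ∈ₗ? used)))
  ... | no none = [] , tt , none
  exhaust zero F used bound | yes (v , u , (_ , Fu , _) , _) =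
    contradiction bound (<⇒≱ (subst (∣ tabulate F ∣ <_) (∣⊤∣≡n n)
      (p⊂q⇒∣p∣<∣q∣ (⊆⊤ , u , ∈⊤ , ∉-tabulate F Fu))))
  exhaust (suc fuel) F used bound | yes (v , u , canF@(_ , Fu , _) , v∉used)
    with exhaust fuel (fill F u) (v ∷ used)
           (≤-trans bound (+-monoʳ-< fuel (⊆ᶠ⇒∣∣< (fill-⊇ F u) Fu (fill-self F u))))
  ... | s , valid , exhausted = (v , u) ∷ s , (canF , v∉used , valid) , exhausted

  stabilise : ∀ F → Σ _ λ s → ValidFrom H F [] s × Stable (after F s)
  stabilise F with exhaust n F [] (m≤m+n n _)
  ... | s , valid , exhausted = s , valid , exhausted⇒stable s F valid exhausted

  stable-full⇒zfs : ∀ S → (∀ C → Stable C → initial S ⊆ᶠ C → Full C) → IsZeroForcingSet H S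
  stable-full⇒zfs S fills with stabilise (initial S)
  ... | s , valid , stable = s , valid , fills _ stable (after-⊇ s (initial S))

  zfs? : ∀ S → Dec (IsZeroForcingSet H S)
  zfs? S with stabilise (initial S)
  ... | s , valid , stable with all? (λ w → after (initial S) s w Bool.≟ true)
  ...   | yes full = yes (s , valid , full)
  ...   | no ¬full = no λ zfs → ¬full (zfs⇒stable-full {S} zfs stable (after-⊇ s (initial S)))

  Z-exists : Σ ℕ (IsZ H)
  Z-exists with least (λ k → anySubset? (λ S → zfs? S ×-dec ∣ S ∣ ℕ.≟ k))
                      (⊤ , ([] , tt , λ w → []=⇒lookup (∈⊤ {x = w})) , ∣⊤∣≡n n)
  ... | k , witness , minimal = k , witness , λ S zfs → minimal ∣ S ∣ (S , zfs , refl)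

  forced-unfilled : ∀ s F used {v u} → ValidFrom H F used s → (v , u) ∈ₗ s → F u ≡ false
  forced-unfilled (_ ∷ s) F used ((_ , Fu , _) , _) (here refl) = Fu
  forced-unfilled ((_ , x) ∷ s) F used (_ , _ , valid) (there vu∈s) =
    proj₂ (fill-unfilled F (forced-unfilled s (fill F x) _ valid vu∈s))

  force-adjacent : ∀ s F used {v u} → ValidFrom H F used s → (v , u) ∈ₗ s → adj H v u ≡ true
  force-adjacent (_ ∷ s) F used ((_ , _ , vu , _) , _) (here refl) = vu
  force-adjacent ((_ , x) ∷ s) F used (_ , _ , valid) (there vu∈s) =
    force-adjacent s (fill F x) _ valid vu∈s

  used-never-forces : ∀ s F used {v u} → ValidFrom H F used s → v ∈ₗ used → ¬ (v , u) ∈ₗ s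
  used-never-forces (_ ∷ s) F used (_ , v∉used , _) v∈used (here refl) = v∉used v∈used
  used-never-forces ((y , x) ∷ s) F used (_ , _ , valid) v∈used (there vu∈s) =
    used-never-forces s (fill F x) (y ∷ used) valid (there v∈used) vu∈s

  forces-once : ∀ s F used {v u u′} → ValidFrom H F used s →
                (v , u) ∈ₗ s → (v , u′) ∈ₗ s → u ≡ u′
  forces-once (_ ∷ s) F used valid (here refl) (here refl) = refl
  forces-once ((v , x) ∷ s) F used (_ , _ , valid) (here refl) (there vu′∈s) =
    contradiction vu′∈s (used-never-forces s (fill F x) (v ∷ used) valid (here refl))
  forces-once ((v , x) ∷ s) F used (_ , _ , valid) (there vu∈s) (here refl) =
    contradiction vu∈s (used-never-forces s (fill F x) (v ∷ used) valid (here refl))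
  forces-once ((y , x) ∷ s) F used (_ , _ , valid) (there vu∈s) (there vu′∈s) =
    forces-once s (fill F x) (y ∷ used) valid vu∈s vu′∈s

  Simplicial : Fin n → Set
  Simplicial z = ∀ u w → adj H z u ≡ true → adj H z w ≡ true → u ≢ w → adj H u w ≡ true

  -- If w → z came first, every neighbour of z other than w was already filled, so
  -- z has nothing left to force; if z → u came first, z was not yet filled.
  simplicial⇒¬forces-forced : ∀ {z} → Simplicial z → ∀ s F used {u w} → ValidFrom H F used s →
                              (z , u) ∈ₗ s → (w , z) ∈ₗ s → ⊥
  simplicial⇒¬forces-forced {z} _ (_ ∷ s) F used ((_ , _ , zz , _) , _) (here refl) (here refl) =
    true≢false (trans (sym zz) (irrefl H z))
  simplicial⇒¬forces-forced {z} _ ((_ , u) ∷ s) F used ((Fz , _) , _ , valid) (here refl) (there wz∈s) =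
    true≢false (trans (sym Fz) (proj₂ (fill-unfilled F (forced-unfilled s (fill F u) _ valid wz∈s))))
  simplicial⇒¬forces-forced {z} simplicial ((w , _) ∷ s) F used {u} ((Fw , _ , wz , only) , _ , valid)
                            (there zu∈s) (here refl) =
    proj₁ u≢z×Fu (only u (simplicial w u (trans (Graph.sym H z w) wz) zu w≢u) (proj₂ u≢z×Fu))
    where
    zu : adj H z u ≡ true
    zu = force-adjacent s (fill F z) (w ∷ used) valid zu∈s

    u≢z×Fu : u ≢ z × F u ≡ false
    u≢z×Fu = fill-unfilled F (forced-unfilled s (fill F z) (w ∷ used) valid zu∈s)

    w≢u : w ≢ u
    w≢u refl = true≢false (trans (sym Fw) (proj₂ u≢z×Fu))
  simplicial⇒¬forces-forced simplicial ((y , x) ∷ s) F used (_ , _ , valid) (there zu∈s) (there wz∈s) =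
    simplicial⇒¬forces-forced simplicial s (fill F x) (y ∷ used) valid zu∈s wz∈s

  forces⇒target : ∀ {v : Fin n} s → Forces v s → ∃ λ u → (v , u) ∈ₗ s
  forces⇒target s v∈ with ∈-map⁻ proj₁ v∈
  ... | (_ , u) , vu∈s , refl = u , vu∈s

  simplicial-forcer⇒unforced : ∀ {z u} → Simplicial z → ∀ s F used → ValidFrom H F used s →
                               (z , u) ∈ₗ s → ¬ Forced z s
  simplicial-forcer⇒unforced simplicial s F used valid zu∈s forced with ∈-map⁻ proj₂ forced
  ... | (w , _) , wz∈s , refl = simplicial⇒¬forces-forced simplicial s F used valid zu∈s wz∈s

module Deletion {m : ℕ} (G : Graph (suc m)) (z : Fin (suc m)) where

  G′ : Graph m
  G′ = deleteVertex G z

  private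
    module ZG  = ZeroForcing G
    module ZG′ = ZeroForcing G′

  Extends : Filling (suc m) → Filling m → Set
  Extends F₁ F = F₁ z ≡ true × (∀ j → F₁ (punchIn z j) ≡ F j)

  insertAt-extends : ∀ (S : Subset m) → Extends (initial (insertAt S z inside)) (initial S)
  insertAt-extends S = insertAt-lookup S z inside , insertAt-punchIn S z inside

  extend : Filling m → Filling (suc m)
  extend C = initial (insertAt (tabulate C) z inside)

  extend-extends : ∀ C → Extends (extend C) C
  extend-extends C =
    proj₁ (insertAt-extends (tabulate C)) ,
    λ j → trans (proj₂ (insertAt-extends (tabulate C)) j) (lookup∘tabulate C j)

  extends-full : ∀ {F₁ F} → Extends F₁ F → Full F → Full F₁
  extends-full (F₁z , F₁≗F) full w with ≡-or-punchIn z w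
  ... | inj₁ refl       = F₁z
  ... | inj₂ (j , refl) = trans (F₁≗F j) (full j)

  fill-extends : ∀ {F₁ F} u → Extends F₁ F → Extends (fill F₁ (punchIn z u)) (fill F u)
  fill-extends {F₁} {F} u (F₁z , F₁≗F) = trans (fill-other F₁ (punchInᵢ≢i z u ∘ sym)) F₁z , agree
    where
    agree : ∀ j → fill F₁ (punchIn z u) (punchIn z j) ≡ fill F u j
    agree j with j ≟ u
    ... | yes refl = fill-self F₁ (punchIn z j)
    ... | no  j≢u  = trans (fill-other F₁ (j≢u ∘ punchIn-injective z j u)) (F₁≗F j)

  canForce-lift : ∀ {F₁ F v u} → Extends F₁ F → CanForce G′ F v u →
                  CanForce G F₁ (punchIn z v) (punchIn z u)
  canForce-lift {F₁} {F} {v} {u} (F₁z , F₁≗F) (Fv , Fu , vu , only) =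
    trans (F₁≗F v) Fv , trans (F₁≗F u) Fu , vu , only₁
    where
    only₁ : ∀ w → adj G (punchIn z v) w ≡ true → F₁ w ≡ false → w ≡ punchIn z u
    only₁ w vw F₁w with ≡-or-punchIn z w
    ... | inj₁ refl       = ⊥-elim (true≢false (trans (sym F₁z) F₁w))
    ... | inj₂ (j , refl) = cong (punchIn z) (only j vw (trans (sym (F₁≗F j)) F₁w))

  canForce-restrict : ∀ {F₁ F v u} → Extends F₁ F → CanForce G F₁ (punchIn z v) (punchIn z u) →
                      CanForce G′ F v u
  canForce-restrict {v = v} {u} (_ , F₁≗F) (F₁v , F₁u , vu , only) =
    trans (sym (F₁≗F v)) F₁v , trans (sym (F₁≗F u)) F₁u , vu ,
    λ w vw Fw → punchIn-injective z w u (only (punchIn z w) vw (trans (F₁≗F w) Fw))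

  lift : List (Force m) → List (Force (suc m))
  lift []            = []
  lift ((v , u) ∷ s) = (punchIn z v , punchIn z u) ∷ lift s

  lift-valid : ∀ s {F₁ F used} → Extends F₁ F → ValidFrom G′ F used s →
               ValidFrom G F₁ (map (punchIn z) used) (lift s)
  lift-valid []            ext _                          = tt
  lift-valid ((v , u) ∷ s) {used = used} ext (canF , v∉used , valid) =
    canForce-lift ext canF , v∉used ∘ unpunch , lift-valid s (fill-extends u ext) valid
    where
    unpunch : punchIn z v ∈ₗ map (punchIn z) used → v ∈ₗ used
    unpunch v∈ with ∈-map⁻ (punchIn z) v∈
    ... | x , x∈used , v≡x rewrite punchIn-injective z v x v≡x = x∈used

  after-lift : ∀ s {F₁ F} → Extends F₁ F → Extends (after F₁ (lift s)) (after F s)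
  after-lift []            ext = ext
  after-lift ((v , u) ∷ s) ext = after-lift s (fill-extends u ext)

  lift-idle : ∀ s → ¬ Forces z (lift s)
  lift-idle ((v , u) ∷ s) (here z≡v)  = punchInᵢ≢i z v (sym z≡v)
  lift-idle ((v , u) ∷ s) (there z∈) = lift-idle s z∈

  lift-unforced : ∀ s → ¬ Forced z (lift s)
  lift-unforced ((v , u) ∷ s) (here z≡u)  = punchInᵢ≢i z u (sym z≡u)
  lift-unforced ((v , u) ∷ s) (there z∈) = lift-unforced s z∈

  lift-zfs : ∀ {S s} → ValidSeq G′ S s → Full (after (initial S) s) →
             ValidSeq G (insertAt S z inside) (lift s) × Full (after (initial (insertAt S z inside)) (lift s))
  lift-zfs {S} {s} valid full =
    lift-valid s (insertAt-extends S) valid , extends-full (after-lift s (insertAt-extends S)) full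

  -- Any stable filling C of G∖z, extended by filling z, absorbs every force of s: forces
  -- into z trivially, forces by z because X supplies their targets, the rest by stability of C.
  project-zfs : ∀ {S s} X → ValidSeq G S s → Full (after (initial S) s) → S ⊆ X →
                (∀ {u} → (z , u) ∈ₗ s → u ∈ X) → IsZeroForcingSet G′ (removeAt X z)
  project-zfs {S} {s} X valid full S⊆X z-targets = ZG′.stable-full⇒zfs (removeAt X z) fills
    where
    fills : ∀ C → ZG′.Stable C → initial (removeAt X z) ⊆ᶠ C → Full C
    fills C stable X∖z⊆C j = trans (sym (proj₂ ext j)) (filled (punchIn z j))
      where
      ext : Extends (extend C) C
      ext = extend-extends C

      X⊆C₁ : ∀ w → w ∈ X → extend C w ≡ true
      X⊆C₁ w w∈X with ≡-or-punchIn z w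
      ... | inj₁ refl       = proj₁ ext
      ... | inj₂ (i , refl) = trans (proj₂ ext i) (X∖z⊆C i ([]=⇒lookup (∈-removeAt⁺ X z w∈X)))

      absorbs : ∀ {f} → f ∈ₗ s → ZG.Absorbs (extend C) f
      absorbs {v , u} vu∈s F F⊆C₁ canF with ≡-or-punchIn z v | ≡-or-punchIn z u
      ... | _               | inj₁ refl       = proj₁ ext
      ... | inj₁ refl       | inj₂ _          = X⊆C₁ u (z-targets vu∈s)
      ... | inj₂ (i , refl) | inj₂ (j , refl) =
        Bool.¬-not λ C₁u → stable i j (canForce-restrict ext (ZG.canForce-mono F⊆C₁ C₁u canF))

      filled : Full (extend C)
      filled w = ZG.after-⊆ s (initial S) [] valid absorbs
                   (λ x Sx → X⊆C₁ x (S⊆X (lookup⇒[]= x S Sx))) w (full w)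

  delete-idle : ∀ S s → ValidSeq G S s → Full (after (initial S) s) → ¬ Forces z s →
                IsZeroForcingSet G′ (removeAt S z)
  delete-idle S s valid full idle =
    project-zfs {S} {s} S valid full id (λ z→u → contradiction (∈-map⁺ proj₁ z→u) idle)

  -- If z forces u₀, then z was never forced, hence z ∈ S, and u₀ may take the place of z.
  delete-zfs : ZG.Simplicial z → ∀ S → IsZeroForcingSet G S →
               ∃ λ R → IsZeroForcingSet G′ R × ∣ R ∣ ≤ ∣ S ∣
  delete-zfs simplicial S (s , valid , full) with z ∈ₗ? map proj₁ s
  ... | no  idle   = removeAt S z , delete-idle S s valid full idle , ∣removeAt∣≤∣p∣ S z
  ... | yes forces with ZG.forces⇒target s forces
  ...   | u₀ , z→u₀ = removeAt X z , project-zfs X valid full (p⊆p∪q _) targets , size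
    where
    X : Subset (suc m)
    X = S ∪ ⁅ u₀ ⁆

    targets : ∀ {u} → (z , u) ∈ₗ s → u ∈ X
    targets z→u rewrite ZG.forces-once s (initial S) [] valid z→u z→u₀ =
      q⊆p∪q S ⁅ u₀ ⁆ (x∈⁅x⁆ u₀)

    z∈S : z ∈ S
    z∈S = unforced⇒initial full (ZG.simplicial-forcer⇒unforced simplicial s (initial S) [] valid z→u₀)

    size : ∣ removeAt X z ∣ ≤ ∣ S ∣
    size = ≤-pred (begin
      suc ∣ removeAt X z ∣ ≡⟨ sym (x∈p⇒∣p∣≡suc∣removeAt∣ (p⊆p∪q ⁅ u₀ ⁆ z∈S)) ⟩
      ∣ X ∣                ≤⟨ ∣p∪q∣≤∣p∣+∣q∣ S ⁅ u₀ ⁆ ⟩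
      ∣ S ∣ + ∣ ⁅ u₀ ⁆ ∣   ≡⟨ cong (∣ S ∣ +_) (∣⁅x⁆∣≡1 u₀) ⟩
      ∣ S ∣ + 1            ≡⟨ +-comm ∣ S ∣ 1 ⟩
      suc ∣ S ∣            ∎)
      where open ≤-Reasoning

  Z-delete≤Z : ∀ {k k′} → ZG.Simplicial z → IsZ G k → IsZ G′ k′ → k′ ≤ k
  Z-delete≤Z simplicial ((S , zfs , refl) , _) (_ , k′-min) with delete-zfs simplicial S zfs
  ... | R , zfsR , R≤S = ≤-trans (k′-min R zfsR) R≤S

  Z≤Z-delete+1 : ∀ {k k′} → IsZ G k → IsZ G′ k′ → k ≤ suc k′
  Z≤Z-delete+1 (_ , k-min) ((S′ , (s , valid , full) , refl) , _) =
    subst (_ ≤_) (∣insertAt∣ S′ z inside)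
          (k-min (insertAt S′ z inside) (lift s , lift-zfs {S′} {s} valid full))

  critical : ∀ {k′} → IsZ G (suc k′) → IsZ G′ k′ → Critical G z
  critical (_ , k-min) ((S′ , (s , valid , full) , refl) , _) =
    S₁ , lift s ,
    (((lift s , lifted) , optimal) , proj₁ lifted , ZG.full⇒exhausted (proj₂ lifted)) ,
    lift-idle s , lift-unforced s
    where
    S₁ : Subset (suc m)
    S₁ = insertAt S′ z inside

    lifted : ValidSeq G S₁ (lift s) × Full (after (initial S₁) (lift s))
    lifted = lift-zfs {S′} {s} valid full

    optimal : ∀ S → IsZeroForcingSet G S → ∣ S₁ ∣ ≤ ∣ S ∣
    optimal S zfsS = subst (_≤ ∣ S ∣) (sym (∣insertAt∣ S′ z inside)) (k-min S zfsS)

  uncritical : ∀ {k} → ZG.Simplicial z → IsZ G k → IsZ G′ k → Uncritical G z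
  uncritical simplicial ((S₀ , zfs₀ , refl) , _) (_ , k-min′) S s ((zfs , optimal) , valid , maximal)
    with z ∈ₗ? map proj₁ s | z ∈ₗ? map proj₂ s
  ... | yes forces | yes forced  =
    ⊥-elim (ZG.simplicial-forcer⇒unforced simplicial s _ [] valid (proj₂ (ZG.forces⇒target s forces)) forced)
  ... | yes forces | no unforced = inj₁ (forces , unforced)
  ... | no idle    | yes forced  = inj₂ (forced , idle)
  ... | no idle    | no unforced = ⊥-elim (1+n≰n (begin
      suc ∣ removeAt S z ∣ ≡⟨ sym (x∈p⇒∣p∣≡suc∣removeAt∣ z∈S) ⟩
      ∣ S ∣                ≤⟨ optimal S₀ zfs₀ ⟩
      ∣ S₀ ∣               ≤⟨ k-min′ (removeAt S z) (delete-idle S s valid full idle) ⟩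
      ∣ removeAt S z ∣     ∎))
    where
    open ≤-Reasoning
    full : Full (after (initial S) s)
    full = ZG.maximal⇒full {S} {s} zfs valid maximal

    z∈S : z ∈ S
    z∈S = unforced⇒initial {S = S} {s} full unforced

clique-degree⇒simplicial : ∀ {m} (G : Graph (suc m)) (T : Subset (suc m)) z →
                           IsClique G T → z ∈ T → deg G z + 1 ≡ ∣ T ∣ → ZeroForcing.Simplicial G z
clique-degree⇒simplicial {m} G T z clique z∈T deg+1≡∣T∣ u w zu zw u≢w = clique u w (N⊆T zu) (N⊆T zw) u≢w
  where
  N : Subset (suc m)
  N = tabulate (adj G z)

  T∖z⊆N∖z : removeAt T z ⊆ removeAt N z
  T∖z⊆N∖z {j} j∈T = ∈-removeAt⁺ N z (∈-tabulate⁺ (adj G z)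
    (clique z (punchIn z j) z∈T (∈-removeAt⁻ T z j∈T) (punchInᵢ≢i z j ∘ sym)))

  ∣N∖z∣≡∣T∖z∣ : ∣ removeAt N z ∣ ≡ ∣ removeAt T z ∣
  ∣N∖z∣≡∣T∖z∣ = suc-injective (begin
    suc ∣ removeAt N z ∣ ≡⟨ cong suc (sym (x∉p⇒∣p∣≡∣removeAt∣ z∉N)) ⟩
    suc (deg G z)        ≡⟨ +-comm 1 (deg G z) ⟩
    deg G z + 1          ≡⟨ deg+1≡∣T∣ ⟩
    ∣ T ∣                ≡⟨ x∈p⇒∣p∣≡suc∣removeAt∣ z∈T ⟩
    suc ∣ removeAt T z ∣ ∎)
    where
    open ≡-Reasoning
    z∉N : z ∉ N
    z∉N = ∉-tabulate (adj G z) (irrefl G z)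

  N⊆T : ∀ {w} → adj G z w ≡ true → w ∈ T
  N⊆T {w} zw with ≡-or-punchIn z w
  ... | inj₁ refl       = ⊥-elim (true≢false (trans (sym zw) (irrefl G z)))
  ... | inj₂ (j , refl) = ∈-removeAt⁻ T z
    (p⊆q∧∣q∣≤∣p∣⇒q⊆p T∖z⊆N∖z (≤-reflexive ∣N∖z∣≡∣T∖z∣)
      (∈-removeAt⁺ N z (∈-tabulate⁺ (adj G z) zw)))

theorem5p5 : ∀ {m} (G : Graph (suc m)) (T : Subset (suc m)) (z : Fin (suc m)) →
    IsClique G T → z ∈ T → deg G z + 1 ≡ ∣ T ∣ →
    (Critical G z ⊎ Uncritical G z) ×
    (Σ ℕ λ k → Σ ℕ λ k′ → IsZ G k × IsZ (deleteVertex G z) k′ × (k′ ≡ k ⊎ k′ + 1 ≡ k))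
theorem5p5 G T z clique z∈T deg+1≡∣T∣
  with ZeroForcing.Z-exists G | ZeroForcing.Z-exists (deleteVertex G z)
... | k , Zk | k′ , Zk′ = proj₁ conclusion , k , k′ , Zk , Zk′ , proj₂ conclusion
  where
  open Deletion G z
  simplicial : ZeroForcing.Simplicial G z
  simplicial = clique-degree⇒simplicial G T z clique z∈T deg+1≡∣T∣

  conclusion : (Critical G z ⊎ Uncritical G z) × (k′ ≡ k ⊎ k′ + 1 ≡ k)
  conclusion with m≤n⇒m<n∨m≡n (Z-delete≤Z simplicial Zk Zk′)
  ... | inj₂ k′≡k = inj₂ (uncritical simplicial Zk (subst (IsZ G′) k′≡k Zk′)) , inj₁ k′≡k
  ... | inj₁ k′<k =
    inj₁ (critical (subst (IsZ G) k≡1+k′ Zk) Zk′) , inj₂ (trans (+-comm k′ 1) (sym k≡1+k′))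
    where
    k≡1+k′ : k ≡ suc k′
    k≡1+k′ = ≤-antisym (Z≤Z-delete+1 Zk Zk′) k′<k
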